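{- Let $\mathcal{M}=\langle\Sigma,\mathcal{S},s_i,s_f,\delta\rangle$ be a deterministic Turing machine with semi-infinite tape and $x=x_1\cdots x_n$ an input string containing no blank symbol. Let $\mathcal{P}_\mathcal{M}$ be the program consisting of the rule $\mathrm{conf}(s_f,L,V,R).$ together with, for each state $s\in\mathcal{S}\setminus\{s_f\}$ and each symbol $v\in\Sigma$: the rule $\mathrm{conf}(s,[V|L],v,R)\leftarrow\mathrm{conf}(s',L,V,[v'|R])$ if $\delta(s,v)=(s',v',\leftarrow)$; and the two rules $\mathrm{conf}(s,L,v,[V|R])\leftarrow\mathrm{conf}(s',[v'|L],V,R)$ and $\mathrm{conf}(s,L,v,[\,])\leftarrow\mathrm{conf}(s',[v'|L],\sqcup,[\,])$ if $\delta(s,v)=(s',v',\rightarrow)$ (here $L,V,R$ are variables, and states and symbols are constants). Let $\mathcal{Q}_{\mathcal{M}(x)}$ be $\mathrm{conf}(s_i,[\,],x_1,[x_2,\dots,x_n])$ if $n>0$ and $\mathrm{conf}(s_i,[\,],\sqcup,[\,])$ otherwise. Then $\mathcal{P}_\mathcal{M}$ bravely (equivalently, cautiously) entails $\mathcal{Q}_{\mathcal{M}(x)}$ if and only if $\mathcal{M}$ accepts $x$.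
   Context: A Turing machine with semi-infinite tape is $\langle\Sigma,\mathcal{S},s_i,s_f,\delta\rangle$: alphabet $\Sigma$ containing the blank $\sqcup$, state set $\mathcal{S}$, distinct initial and final states $s_i,s_f$, and transition function $\delta:\mathcal{S}\times\Sigma\to\mathcal{S}\times\Sigma\times\{\leftarrow,\rightarrow\}$. Initially the state is $s_i$, the tape holds $x$ followed by infinitely many blanks, and the head is on the first cell; if the current state is $s$, the scanned symbol $v$ and $\delta(s,v)=(s',v',m)$, the machine writes $v'$, moves its head in direction $m$ and enters $s'$. $\mathcal{M}$ accepts $x$ if $s_f$ is reached at some point. Lists are terms built from the constant $[\,]$ and a binary function symbol, $[h|t]$ having head $h$ and tail $t$. A rule $a_1\vee\dots\vee a_n\leftarrow$ body; a program is a finite set of rules; $\mathrm{Ground}(\mathcal{P})$ is the set of ground instances over ground terms built from $\mathcal{P}$'s function symbols; stable models are subset-minimal models $M$ of the reduct $\mathrm{Ground}(\mathcal{P})^M$ (for a negation-free program, its unique minimal model). A query is a ground atom; brave (cautious) entailment means it belongs to some (every) stable model. -}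

module Defs where

open import Data.Nat using (ℕ; zero; suc)
open import Data.Fin using (Fin)
open import Data.Fin.Properties using () renaming (_≟_ to _≟ᶠ_)
open import Data.Nat.Properties using () renaming (_≟_ to _≟ⁿ_)
open import Data.List using (List; []; _∷_; _++_; concatMap; allFin)
open import Data.List.Membership.Propositional using (_∈_)
open import Data.List.Relation.Unary.All using (All)
open import Data.List.Relation.Unary.Any using (Any)
open import Data.Maybe using (Maybe; just; nothing)
open import Data.Product using (Σ; ∃; _×_; _,_; proj₁)
open import Data.Empty using (⊥)
open import Relation.Nullary using (¬_; yes; no)
open import Relation.Binary.PropositionalEquality using (_≡_; _≢_)

data Dir : Set where
  left right : Dir

record TM : Set where
  field
    k      : ℕ
    m      : ℕ
    blank  : Fin k
    sᵢ     : Fin m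
    sf    : Fin m
    sᵢ≢sf : sᵢ ≢ sf
    δ      : Fin m → Fin k → Fin m × Fin k × Dir

module _ (𝓜 : TM) where
  open TM 𝓜

  -- configuration: current state, head position (cell 0 is the first cell), tape contents
  record Config : Set where
    constructor cfg
    field
      state : Fin m
      pos   : ℕ
      tape  : ℕ → Fin k

  update : (ℕ → Fin k) → ℕ → Fin k → (ℕ → Fin k)
  update t p v i with i ≟ⁿ p
  ... | yes _ = v
  ... | no  _ = t i

  -- one step; a left move on the first cell leaves no successor (the machine crashes)
  step : Config → Maybe Config
  step (cfg q i t) with δ q (t i)
  ... | q' , w , right = just (cfg q' (suc i) (update t i w))
  ... | q' , w , left with i
  ...   | zero  = nothing
  ...   | suc j = just (cfg q' j (update t (suc j) w))

  run : ℕ → Config → Maybe Config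
  run zero    c = just c
  run (suc n) c with step c
  ... | nothing = nothing
  ... | just c' = run n c'

  initTape : List (Fin k) → ℕ → Fin k
  initTape []      _       = blank
  initTape (v ∷ x) zero    = v
  initTape (v ∷ x) (suc i) = initTape x i

  initConfig : List (Fin k) → Config
  initConfig x = (cfg sᵢ zero (initTape x))

  Accepts : List (Fin k) → Set
  Accepts x = Σ ℕ λ n → Σ Config λ c → run n (initConfig x) ≡ just c × Config.state c ≡ sf

module _ (Const : Set) where

  data Term (X : Set) : Set where
    var  : X → Term X
    con  : Const → Term X
    nil  : Term X
    cons : Term X → Term X → Term X

  data Atom (X : Set) : Set where
    conf : Term X → Term X → Term X → Term X → Atom X

  record Rule (X : Set) : Set where
    constructor rule
    field
      head : List (Atom X)   -- a₁ ∨ … ∨ aₙ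
      pos  : List (Atom X)
      neg  : List (Atom X)

  GTerm : Set
  GTerm = Term ⊥

  GAtom : Set
  GAtom = Atom ⊥

  substT : ∀ {X} → (X → GTerm) → Term X → GTerm
  substT σ (var x)    = σ x
  substT σ (con c)    = con c
  substT σ nil        = nil
  substT σ (cons h t) = cons (substT σ h) (substT σ t)

  substA : ∀ {X} → (X → GTerm) → Atom X → GAtom
  substA σ (conf a b c d) = conf (substT σ a) (substT σ b) (substT σ c) (substT σ d)

  Interp : Set₁
  Interp = GAtom → Set

  _⊆_ : Interp → Interp → Set
  I ⊆ J = ∀ a → I a → J a

  -- I is a model of the reduct Ground(𝓟)^M: for each rule r ∈ 𝓟 and each ground
  -- instance σ whose negative body is false in M (i.e. the instance survives the reduct),
  -- if the positive body holds in I then some head atom holds in I.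
  ModelOfReduct : ∀ {X} → List (Rule X) → Interp → Interp → Set
  ModelOfReduct 𝓟 M I =
    ∀ r → r ∈ 𝓟 → (σ : _ → GTerm) →
      All (λ b → ¬ M (substA σ b)) (Rule.neg r) →
      All (λ b → I (substA σ b)) (Rule.pos r) →
      Any (λ a → I (substA σ a)) (Rule.head r)

  StableModel : ∀ {X} → List (Rule X) → Interp → Set₁
  StableModel 𝓟 M = ModelOfReduct 𝓟 M M × (∀ I → ModelOfReduct 𝓟 M I → I ⊆ M → M ⊆ I)

  BravelyEntails : ∀ {X} → List (Rule X) → GAtom → Set₁
  BravelyEntails 𝓟 q = Σ Interp λ M → StableModel 𝓟 M × M q

  CautiouslyEntails : ∀ {X} → List (Rule X) → GAtom → Set₁
  CautiouslyEntails 𝓟 q = ∀ M → StableModel 𝓟 M → M q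

module _ (𝓜 : TM) where
  open TM 𝓜

  data Const : Set where
    st : Fin m → Const
    sy : Fin k → Const

  data Var : Set where
    L V R : Var

  T : Set → Set
  T = Term Const

  st' : ∀ {X} → Fin m → T X
  st' s = con (st s)

  sy' : ∀ {X} → Fin k → T X
  sy' v = con (sy v)

  v' : Var → T Var
  v' = var

  fact : Atom Const Var → Rule Const Var
  fact a = rule (a ∷ []) [] []

  _⟵_ : Atom Const Var → Atom Const Var → Rule Const Var
  a ⟵ b = rule (a ∷ []) (b ∷ []) []

  rulesFor : Fin m → Fin k → List (Rule Const Var)
  rulesFor s v with δ s v
  ... | s₁ , w , left =
        (conf (st' s) (cons (v' V) (v' L)) (sy' v) (v' R)
          ⟵ conf (st' s₁) (v' L) (v' V) (cons (sy' w) (v' R))) ∷ []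
  ... | s₁ , w , right =
        (conf (st' s) (v' L) (sy' v) (cons (v' V) (v' R))
          ⟵ conf (st' s₁) (cons (sy' w) (v' L)) (v' V) (v' R)) ∷
        (conf (st' s) (v' L) (sy' v) nil
          ⟵ conf (st' s₁) (cons (sy' w) (v' L)) (sy' blank) nil) ∷ []

  rulesForState : Fin m → List (Rule Const Var)
  rulesForState s with s ≟ᶠ sf
  ... | yes _ = []
  ... | no  _ = concatMap (rulesFor s) (allFin k)

  program : List (Rule Const Var)
  program = fact (conf (st' sf) (v' L) (v' V) (v' R))
          ∷ concatMap rulesForState (allFin m)

  symList : List (Fin k) → GTerm Const
  symList []      = nil
  symList (v ∷ x) = cons (sy' v) (symList x)

  query : List (Fin k) → GAtom Const
  query []      = conf (st' sᵢ) nil (sy' blank) nil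
  query (v ∷ x) = conf (st' sᵢ) nil (sy' v) (symList x)

-- The program is definite, so it has exactly one stable model: the set of
-- derivable atoms, contained in every model of every reduct.  Brave and
-- cautious entailment therefore both mean derivability.  An atom
-- conf(s, L, V, R) with L, V, R lists of symbols describes the configuration
-- in state s whose tape reads reverse(L) V R followed by blanks, with the
-- head on V; each non-fact rule derives the description of a configuration
-- from that of its successor.  Hence, by induction over derivations in one
-- direction and over the length of the run in the other, the description of
-- a configuration is derivable iff the machine reaches sf from it.
module Submission where

open import Defs
open import Data.Fin using (Fin)
open import Data.List using (List)
open import Data.List.Relation.Unary.All using (All)
open import Data.Product using (_×_)
open import Function.Bundles using (_⇔_)
open import Relation.Binary.PropositionalEquality using (_≢_)

open import Data.Empty using (⊥-elim)
open import Data.Fin.Properties using () renaming (_≟_ to _≟ᶠ_)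
open import Data.List using ([]; _∷_; _++_; _ʳ++_; reverse; length)
open import Data.List.Properties using (ʳ++-defn; length-reverse)
open import Data.List.Membership.Propositional using (_∈_; lose)
open import Data.List.Membership.Propositional.Properties using (∈-concatMap⁺; ∈-allFin)
open import Data.List.Relation.Unary.All using ([]; _∷_; lookup) renaming (head to All-head)
open import Data.List.Relation.Unary.All.Properties using (concat⁺; map⁺; tabulate⁺)
open import Data.List.Relation.Unary.Any using (here; there)
open import Data.List.Relation.Unary.Any.Properties using (singleton⁻)
open import Data.Maybe using (Maybe; just; nothing)
open import Data.Maybe.Relation.Binary.Pointwise using (Pointwise; just; nothing)
open import Data.Nat using (ℕ; zero; suc)
open import Data.Nat.Properties using () renaming (_≟_ to _≟ⁿ_)
open import Data.Product using (Σ; ∃; ∃₂; _,_; proj₁; proj₂)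
open import Function using (_∘_; flip)
open import Function.Bundles using (mk⇔)
open import Function.Properties.Equivalence using () renaming (trans to ⇔-trans; sym to ⇔-sym)
open import Relation.Binary.PropositionalEquality
  using (_≡_; _≗_; refl; sym; trans; cong; cong₂; subst; module ≡-Reasoning)
open import Relation.Nullary using (yes; no)

pointwise-justʳ : ∀ {A B : Set} {R : A → B → Set} {mx : Maybe A} {y : B} →
  Pointwise R mx (just y) → ∃ λ x → mx ≡ just x × R x y
pointwise-justʳ (just r) = _ , refl , r

pointwise-justˡ : ∀ {A B : Set} {R : A → B → Set} {x : A} {my : Maybe B} →
  Pointwise R (just x) my → ∃ λ y → my ≡ just y × R x y
pointwise-justˡ (just r) = _ , refl , r

module _ {C X : Set} (𝓟 : List (Rule C X)) where

  data Derivable : GAtom C → Set where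
    derive : ∀ {a body} → rule (a ∷ []) body [] ∈ 𝓟 → (σ : X → GTerm C) →
             All (λ b → Derivable (substA C σ b)) body → Derivable (substA C σ a)

  derivable-induction : {P : GAtom C → Set} →
    (∀ {a body} → rule (a ∷ []) body [] ∈ 𝓟 → (σ : X → GTerm C) →
       All (P ∘ substA C σ) body → P (substA C σ a)) →
    ∀ {q} → Derivable q → P q
  derivable-induction {P} step = go
    where
    go : ∀ {q} → Derivable q → P q
    go* : ∀ {σ body} → All (λ b → Derivable (substA C σ b)) body → All (P ∘ substA C σ) body
    go (derive r∈ σ ds) = step r∈ σ (go* ds)
    go* [] = []
    go* (d ∷ ds) = go d ∷ go* ds

  derivable-least : ∀ M {I} → ModelOfReduct C 𝓟 M I → ∀ {q} → Derivable q → I q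
  derivable-least _ mI = derivable-induction λ r∈ σ Is → singleton⁻ (mI _ r∈ σ [] Is)

module _ {C X : Set} where

  Definite : Rule C X → Set
  Definite r = ∃₂ λ a body → r ≡ rule (a ∷ []) body []

  Preserves : (GAtom C → Set) → Rule C X → Set
  Preserves P r = (σ : X → GTerm C) →
    All (P ∘ substA C σ) (Rule.pos r) → All (P ∘ substA C σ) (Rule.head r)

module _ {C X : Set} {𝓟 : List (Rule C X)} where

  derivable-sound : {P : GAtom C → Set} → All (Preserves P) 𝓟 → ∀ {q} → Derivable 𝓟 q → P q
  derivable-sound preserved =
    derivable-induction 𝓟 λ r∈ σ Ps → All-head (lookup preserved r∈ σ Ps)

  module _ (definite : All Definite 𝓟) where

    derivable-model : ∀ M → ModelOfReduct C 𝓟 M (Derivable 𝓟)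
    derivable-model M r r∈ σ _ ds with lookup definite r∈
    ... | _ , _ , refl = here (derive r∈ σ ds)

    derivable-stable : StableModel C 𝓟 (Derivable 𝓟)
    derivable-stable =
      derivable-model (Derivable 𝓟) , λ I mI _ _ → derivable-least 𝓟 (Derivable 𝓟) mI

    brave⇔derivable : ∀ q → BravelyEntails C 𝓟 q ⇔ Derivable 𝓟 q
    brave⇔derivable q = mk⇔
      (λ { (M , (mM , minimal) , Mq) →
             minimal (Derivable 𝓟) (derivable-model M) (λ _ → derivable-least 𝓟 M mM) q Mq })
      (λ d → Derivable 𝓟 , derivable-stable , d)

    cautious⇔derivable : ∀ q → CautiouslyEntails C 𝓟 q ⇔ Derivable 𝓟 q
    cautious⇔derivable q = mk⇔
      (λ entailed → entailed (Derivable 𝓟) derivable-stable)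
      (λ d M stable → derivable-least 𝓟 M (proj₁ stable) d)

module _ (𝓜 : TM) where
  open TM 𝓜
  open ≡-Reasoning

  Tape : Set
  Tape = ℕ → Fin k

  initTape-++-head : ∀ xs w ys → initTape 𝓜 (xs ++ w ∷ ys) (length xs) ≡ w
  initTape-++-head []       w ys = refl
  initTape-++-head (x ∷ xs) w ys = initTape-++-head xs w ys

  initTape-++-elsewhere : ∀ xs {v w ys i} → i ≢ length xs →
    initTape 𝓜 (xs ++ v ∷ ys) i ≡ initTape 𝓜 (xs ++ w ∷ ys) i
  initTape-++-elsewhere []       {i = zero}  i≢ = ⊥-elim (i≢ refl)
  initTape-++-elsewhere []       {i = suc i} _  = refl
  initTape-++-elsewhere (x ∷ xs) {i = zero}  _  = refl
  initTape-++-elsewhere (x ∷ xs) {i = suc i} i≢ = initTape-++-elsewhere xs (i≢ ∘ cong suc)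

  initTape-blank : initTape 𝓜 [] ≗ initTape 𝓜 (blank ∷ [])
  initTape-blank zero    = refl
  initTape-blank (suc i) = refl

  initTape-∷-cong : ∀ a {ys zs} → initTape 𝓜 ys ≗ initTape 𝓜 zs →
    initTape 𝓜 (a ∷ ys) ≗ initTape 𝓜 (a ∷ zs)
  initTape-∷-cong a e zero    = refl
  initTape-∷-cong a e (suc i) = e i

  initTape-ʳ++-cong : ∀ as {ys zs} → initTape 𝓜 ys ≗ initTape 𝓜 zs →
    initTape 𝓜 (as ʳ++ ys) ≗ initTape 𝓜 (as ʳ++ zs)
  initTape-ʳ++-cong []       e = e
  initTape-ʳ++-cong (a ∷ as) e = initTape-ʳ++-cong as (initTape-∷-cong a e)

  -- The cells left of the head are listed nearest first, as in conf(s, L, V, R).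
  layout : List (Fin k) → Fin k → List (Fin k) → Tape
  layout as v bs = initTape 𝓜 (as ʳ++ v ∷ bs)

  layout-head : ∀ as w bs → layout as w bs (length as) ≡ w
  layout-head as w bs = begin
    initTape 𝓜 (as ʳ++ w ∷ bs) (length as)
      ≡⟨ cong₂ (initTape 𝓜) (ʳ++-defn as) (sym (length-reverse as)) ⟩
    initTape 𝓜 (reverse as ++ w ∷ bs) (length (reverse as))
      ≡⟨ initTape-++-head (reverse as) w bs ⟩
    w ∎

  layout-elsewhere : ∀ as {v w bs i} → i ≢ length as → layout as v bs i ≡ layout as w bs i
  layout-elsewhere as {v} {w} {bs} {i} i≢ = begin
    initTape 𝓜 (as ʳ++ v ∷ bs) i       ≡⟨ cong (flip (initTape 𝓜) i) (ʳ++-defn as) ⟩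
    initTape 𝓜 (reverse as ++ v ∷ bs) i
      ≡⟨ initTape-++-elsewhere (reverse as) (i≢ ∘ flip trans (length-reverse as)) ⟩
    initTape 𝓜 (reverse as ++ w ∷ bs) i ≡⟨ cong (flip (initTape 𝓜) i) (sym (ʳ++-defn as)) ⟩
    initTape 𝓜 (as ʳ++ w ∷ bs) i       ∎

  update-layout : ∀ {t} as {v bs} w → t ≗ layout as v bs →
    update 𝓜 t (length as) w ≗ layout as w bs
  update-layout as {bs = bs} w t≗ i with i ≟ⁿ length as
  ... | yes refl = sym (layout-head as w bs)
  ... | no  i≢   = trans (t≗ i) (layout-elsewhere as i≢)

  record Snapshot : Set where
    constructor ⟨_,_,_,_⟩
    field
      state   : Fin m
      before  : List (Fin k)
      scanned : Fin k
      after   : List (Fin k)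

  ⌜_⌝ : Snapshot → GAtom (Const 𝓜)
  ⌜ ⟨ s , as , v , bs ⟩ ⌝ = conf (st' 𝓜 s) (symList 𝓜 as) (sy' 𝓜 v) (symList 𝓜 bs)

  _describes_ : Snapshot → Config 𝓜 → Set
  ⟨ s , as , v , bs ⟩ describes cfg q i t = q ≡ s × i ≡ length as × t ≗ layout as v bs

  act : Fin m × Fin k × Dir → ℕ → Tape → Maybe (Config 𝓜)
  act (q , w , right) i       t = just (cfg q (suc i) (update 𝓜 t i w))
  act (q , w , left)  zero    t = nothing
  act (q , w , left)  (suc i) t = just (cfg q i (update 𝓜 t (suc i) w))

  step≡act : ∀ q i t → step 𝓜 (cfg q i t) ≡ act (δ q (t i)) i t
  step≡act q zero t with δ q (t zero)
  ... | _ , _ , right = refl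
  ... | _ , _ , left  = refl
  step≡act q (suc i) t with δ q (t (suc i))
  ... | _ , _ , right = refl
  ... | _ , _ , left  = refl

  move : Fin m × Fin k × Dir → List (Fin k) → List (Fin k) → Maybe Snapshot
  move (s₁ , w , left)  []       bs       = nothing
  move (s₁ , w , left)  (l ∷ as) bs       = just ⟨ s₁ , as , l , w ∷ bs ⟩
  move (s₁ , w , right) as       []       = just ⟨ s₁ , w ∷ as , blank , [] ⟩
  move (s₁ , w , right) as       (b ∷ bs) = just ⟨ s₁ , w ∷ as , b , bs ⟩

  next : Snapshot → Maybe Snapshot
  next ⟨ s , as , v , bs ⟩ = move (δ s v) as bs

  move-simulates : ∀ d as {v bs t} → t ≗ layout as v bs →
    Pointwise _describes_ (move d as bs) (act d (length as) t)
  move-simulates (s₁ , w , left)  []               t≗ = nothing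
  move-simulates (s₁ , w , left)  (l ∷ as)         t≗ =
    just (refl , refl , update-layout (l ∷ as) w t≗)
  move-simulates (s₁ , w , right) as {bs = []}     t≗ =
    just (refl , refl , λ i → trans (update-layout as w t≗ i) (blank-under-head i))
    where
    -- the head moves onto a blank that the old layout left implicit
    blank-under-head : layout as w [] ≗ layout (w ∷ as) blank []
    blank-under-head = initTape-ʳ++-cong as (initTape-∷-cong w initTape-blank)
  move-simulates (s₁ , w , right) as {bs = b ∷ bs} t≗ =
    just (refl , refl , update-layout as w t≗)

  next-simulates : ∀ {c κ} → c describes κ → Pointwise _describes_ (next c) (step 𝓜 κ)
  next-simulates {⟨ s , as , v , bs ⟩} {cfg _ _ t} (refl , refl , t≗) =
    subst (Pointwise _describes_ (move (δ s v) as bs)) (sym reads-v)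
      (move-simulates (δ s v) as t≗)
    where
    reads-v : step 𝓜 (cfg s (length as) t) ≡ act (δ s v) (length as) t
    reads-v = trans (step≡act s (length as) t)
      (cong (λ u → act (δ s u) (length as) t) (trans (t≗ (length as)) (layout-head as v bs)))

  ReachesIn : ℕ → Config 𝓜 → Set
  ReachesIn n κ = Σ (Config 𝓜) λ e → run 𝓜 n κ ≡ just e × Config.state e ≡ sf

  Reaches : Config 𝓜 → Set
  Reaches κ = Σ ℕ λ n → ReachesIn n κ

  reachesIn-step : ∀ {n κ κ'} → step 𝓜 κ ≡ just κ' → ReachesIn n κ' → ReachesIn (suc n) κ
  reachesIn-step {κ = κ} step≡ r with step 𝓜 κ | step≡
  ... | just _ | refl = r

  reachesIn-step⁻ : ∀ {n κ} → ReachesIn (suc n) κ →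
    ∃ λ κ' → step 𝓜 κ ≡ just κ' × ReachesIn n κ'
  reachesIn-step⁻ {κ = κ} r with step 𝓜 κ
  ... | just κ'  = κ' , refl , r
  ... | nothing  with r
  ...   | _ , () , _

  Accepting : Snapshot → Set
  Accepting c = ∀ {κ} → c describes κ → Reaches κ

  accepting-final : ∀ {c} → Snapshot.state c ≡ sf → Accepting c
  accepting-final s≡sf {cfg _ _ _} (q≡s , _) = 0 , _ , refl , trans q≡s s≡sf

  accepting-next : ∀ {c c'} → next c ≡ just c' → Accepting c' → Accepting c
  accepting-next next≡ accepting' d
    with pointwise-justˡ (subst (λ mc → Pointwise _describes_ mc _) next≡ (next-simulates d))
  ... | _ , step≡ , d' with accepting' d'
  ...   | n , r = suc n , reachesIn-step step≡ r

  DenotesAccepting : GAtom (Const 𝓜) → Set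
  DenotesAccepting q = ∀ c → q ≡ ⌜ c ⌝ → Accepting c

  fact-preserves : ∀ tL tV tR → DenotesAccepting (conf (st' 𝓜 sf) tL tV tR)
  fact-preserves _ _ _ c@(⟨ _ , _ , _ , _ ⟩) refl = accepting-final {c} refl

  left-preserves : ∀ {s v s₁ w} → δ s v ≡ (s₁ , w , left) → ∀ tL tV tR →
    DenotesAccepting (conf (st' 𝓜 s₁) tL tV (cons (sy' 𝓜 w) tR)) →
    DenotesAccepting (conf (st' 𝓜 s) (cons tV tL) (sy' 𝓜 v) tR)
  left-preserves δ≡ _ _ _ accepting' ⟨ _ , []     , _ , _  ⟩ ()
  left-preserves δ≡ _ _ _ accepting' ⟨ _ , l ∷ as , _ , bs ⟩ refl =
    accepting-next (cong (λ d → move d (l ∷ as) bs) δ≡) (accepting' _ refl)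

  right-preserves : ∀ {s v s₁ w} → δ s v ≡ (s₁ , w , right) → ∀ tL tV tR →
    DenotesAccepting (conf (st' 𝓜 s₁) (cons (sy' 𝓜 w) tL) tV tR) →
    DenotesAccepting (conf (st' 𝓜 s) tL (sy' 𝓜 v) (cons tV tR))
  right-preserves δ≡ _ _ _ accepting' ⟨ _ , _  , _ , []     ⟩ ()
  right-preserves δ≡ _ _ _ accepting' ⟨ _ , as , _ , b ∷ bs ⟩ refl =
    accepting-next (cong (λ d → move d as (b ∷ bs)) δ≡) (accepting' _ refl)

  right-end-preserves : ∀ {s v s₁ w} → δ s v ≡ (s₁ , w , right) → ∀ tL →
    DenotesAccepting (conf (st' 𝓜 s₁) (cons (sy' 𝓜 w) tL) (sy' 𝓜 blank) nil) →
    DenotesAccepting (conf (st' 𝓜 s) tL (sy' 𝓜 v) nil)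
  right-end-preserves δ≡ _ accepting' ⟨ _ , _  , _ , _ ∷ _ ⟩ ()
  right-end-preserves δ≡ _ accepting' ⟨ _ , as , _ , []    ⟩ refl =
    accepting-next (cong (λ d → move d as []) δ≡) (accepting' _ refl)

  RuleM : Set
  RuleM = Rule (Const 𝓜) (Var 𝓜)

  rulesFor-preserve : ∀ s v → All (Preserves DenotesAccepting) (rulesFor 𝓜 s v)
  rulesFor-preserve s v with δ s v in δ≡
  ... | _ , _ , left  =
        (λ { σ (p ∷ []) → left-preserves δ≡ (σ L) (σ V) (σ R) p ∷ [] }) ∷ []
  ... | _ , _ , right =
        (λ { σ (p ∷ []) → right-preserves δ≡ (σ L) (σ V) (σ R) p ∷ [] }) ∷
        (λ { σ (p ∷ []) → right-end-preserves δ≡ (σ L) p ∷ [] }) ∷ []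

  rulesFor-definite : ∀ s v → All Definite (rulesFor 𝓜 s v)
  rulesFor-definite s v with δ s v
  ... | _ , _ , left  = (_ , _ , refl) ∷ []
  ... | _ , _ , right = (_ , _ , refl) ∷ (_ , _ , refl) ∷ []

  program-all : {P : RuleM → Set} → P (fact 𝓜 (conf (st' 𝓜 sf) (v' 𝓜 L) (v' 𝓜 V) (v' 𝓜 R))) →
    (∀ s v → All P (rulesFor 𝓜 s v)) → All P (program 𝓜)
  program-all {P} P-fact P-rulesFor = P-fact ∷ concat⁺ (map⁺ (tabulate⁺ rulesForState-all))
    where
    rulesForState-all : ∀ s → All P (rulesForState 𝓜 s)
    rulesForState-all s with s ≟ᶠ sf
    ... | yes _ = []
    ... | no  _ = concat⁺ (map⁺ (tabulate⁺ (P-rulesFor s)))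

  rulesFor⊆program : ∀ {s v r} → s ≢ sf → r ∈ rulesFor 𝓜 s v → r ∈ program 𝓜
  rulesFor⊆program {s} {v} {r} s≢sf r∈ =
    there (∈-concatMap⁺ (rulesForState 𝓜) (lose (∈-allFin s) r∈rulesForState))
    where
    r∈rulesForState : r ∈ rulesForState 𝓜 s
    r∈rulesForState with s ≟ᶠ sf
    ... | yes s≡sf = ⊥-elim (s≢sf s≡sf)
    ... | no  _    = ∈-concatMap⁺ (rulesFor 𝓜 s) (lose (∈-allFin v) r∈)

  Derivableᴹ : GAtom (Const 𝓜) → Set
  Derivableᴹ = Derivable (program 𝓜)

  assign : (l v r : GTerm (Const 𝓜)) → Var 𝓜 → GTerm (Const 𝓜)
  assign l _ _ L = l
  assign _ v _ V = v
  assign _ _ r R = r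

  final-derivable : ∀ {c} → Snapshot.state c ≡ sf → Derivableᴹ ⌜ c ⌝
  final-derivable {⟨ _ , as , v , bs ⟩} refl =
    derive (here refl) (assign (symList 𝓜 as) (sy' 𝓜 v) (symList 𝓜 bs)) []

  left-rule∈ : ∀ {s v s₁ w} → δ s v ≡ (s₁ , w , left) →
    rule (conf (st' 𝓜 s) (cons (v' 𝓜 V) (v' 𝓜 L)) (sy' 𝓜 v) (v' 𝓜 R) ∷ [])
         (conf (st' 𝓜 s₁) (v' 𝓜 L) (v' 𝓜 V) (cons (sy' 𝓜 w) (v' 𝓜 R)) ∷ []) []
      ∈ rulesFor 𝓜 s v
  left-rule∈ δ≡ rewrite δ≡ = here refl

  right-rules∈ : ∀ {s v s₁ w} → δ s v ≡ (s₁ , w , right) →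
    rule (conf (st' 𝓜 s) (v' 𝓜 L) (sy' 𝓜 v) (cons (v' 𝓜 V) (v' 𝓜 R)) ∷ [])
         (conf (st' 𝓜 s₁) (cons (sy' 𝓜 w) (v' 𝓜 L)) (v' 𝓜 V) (v' 𝓜 R) ∷ []) []
      ∈ rulesFor 𝓜 s v
    × rule (conf (st' 𝓜 s) (v' 𝓜 L) (sy' 𝓜 v) nil ∷ [])
           (conf (st' 𝓜 s₁) (cons (sy' 𝓜 w) (v' 𝓜 L)) (sy' 𝓜 blank) nil ∷ []) []
      ∈ rulesFor 𝓜 s v
  right-rules∈ δ≡ rewrite δ≡ = here refl , there (here refl)

  next-derivable : ∀ {c c'} → Snapshot.state c ≢ sf → next c ≡ just c' →
    Derivableᴹ ⌜ c' ⌝ → Derivableᴹ ⌜ c ⌝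
  next-derivable {⟨ s , as , v , bs ⟩} s≢sf next≡ d with δ s v in δ≡ | as | bs | next≡
  ... | _ , _ , left  | l ∷ as' | bs'      | refl =
    derive (rulesFor⊆program s≢sf (left-rule∈ δ≡))
      (assign (symList 𝓜 as') (sy' 𝓜 l) (symList 𝓜 bs')) (d ∷ [])
  ... | _ , _ , right | as'     | b ∷ bs'  | refl =
    derive (rulesFor⊆program s≢sf (proj₁ (right-rules∈ δ≡)))
      (assign (symList 𝓜 as') (sy' 𝓜 b) (symList 𝓜 bs')) (d ∷ [])
  ... | _ , _ , right | as'     | []       | refl =
    derive (rulesFor⊆program s≢sf (proj₂ (right-rules∈ δ≡)))
      (assign (symList 𝓜 as') nil nil) (d ∷ [])

  derivable-if-reaches : ∀ n {c κ} → ReachesIn n κ → c describes κ → Derivableᴹ ⌜ c ⌝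
  derivable-if-reaches n {c} r d with Snapshot.state c ≟ᶠ sf
  ... | yes s≡sf = final-derivable s≡sf
  derivable-if-reaches zero {κ = cfg _ _ _} (_ , refl , q≡sf) (q≡s , _) | no s≢sf =
    ⊥-elim (s≢sf (trans (sym q≡s) q≡sf))
  derivable-if-reaches (suc n) r d | no s≢sf with reachesIn-step⁻ r
  ... | _ , step≡ , r' with pointwise-justʳ (subst (Pointwise _describes_ _) step≡ (next-simulates d))
  ...   | _ , next≡ , d' = next-derivable s≢sf next≡ (derivable-if-reaches n r' d')

  program-preserves : All (Preserves DenotesAccepting) (program 𝓜)
  program-preserves =
    program-all (λ σ _ → fact-preserves (σ L) (σ V) (σ R) ∷ []) rulesFor-preserve

  program-definite : All Definite (program 𝓜)
  program-definite = program-all (_ , _ , refl) rulesFor-definite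

  reaches⇔derivable : ∀ {c κ} → c describes κ → Reaches κ ⇔ Derivableᴹ ⌜ c ⌝
  reaches⇔derivable d = mk⇔
    (λ (n , r) → derivable-if-reaches n r d)
    (λ derivable → derivable-sound {P = DenotesAccepting} program-preserves derivable _ refl d)

  initial : List (Fin k) → Snapshot
  initial []      = ⟨ sᵢ , [] , blank , [] ⟩
  initial (v ∷ x) = ⟨ sᵢ , [] , v , x ⟩

  initial-describes : ∀ x → initial x describes initConfig 𝓜 x
  initial-describes []      = refl , refl , initTape-blank
  initial-describes (v ∷ x) = refl , refl , λ _ → refl

  query≡⌜initial⌝ : ∀ x → query 𝓜 x ≡ ⌜ initial x ⌝
  query≡⌜initial⌝ []      = refl
  query≡⌜initial⌝ (v ∷ x) = refl

  derivable⇔accepts : ∀ x → Derivableᴹ (query 𝓜 x) ⇔ Accepts 𝓜 x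
  derivable⇔accepts x rewrite query≡⌜initial⌝ x = ⇔-sym (reaches⇔derivable (initial-describes x))

theorem6 : (𝓜 : TM) (x : List (Fin (TM.k 𝓜))) →
    All (λ v → v ≢ TM.blank 𝓜) x →
    (BravelyEntails (Const 𝓜) (program 𝓜) (query 𝓜 x) ⇔ Accepts 𝓜 x)
    × (CautiouslyEntails (Const 𝓜) (program 𝓜) (query 𝓜 x) ⇔ Accepts 𝓜 x)
theorem6 𝓜 x _ =
  ⇔-trans (brave⇔derivable (program-definite 𝓜) (query 𝓜 x)) (derivable⇔accepts 𝓜 x) ,
  ⇔-trans (cautious⇔derivable (program-definite 𝓜) (query 𝓜 x)) (derivable⇔accepts 𝓜 x)
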